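{- Let $k\ge 0$ be an integer, let $G=(X\cup Y,E)$ be a bipartite graph with bipartition $(X,Y)$, and let $<_X$ be a linear order of $X$. Suppose $G$ contains a vertex $v\in X$ with $\deg(v)>2k+2$ and with a neighbor $y\in Y$ that is a leaf. Then there is a linear order $<_Y$ of $Y$ such that $(<_X,<_Y)$ is a 2-layer $k$-planar drawing of $G$ if and only if there is a linear order $<'$ of $Y\setminus\{y\}$ such that $(<_X,<')$ is a 2-layer $k$-planar drawing of $G-y$.
   Context: A leaf is a vertex with exactly one neighbor. A 2-layer drawing of a bipartite graph with bipartition $(X,Y)$ is a pair $(<_X,<_Y)$ of strict linear orders on $X$ and $Y$. Two edges $\{x,y\},\{x',y'\}$ with $x,x'\in X$ distinct and $y,y'\in Y$ distinct cross if $x<_X x'$ and $y'<_Y y$ (or symmetrically). The drawing is $k$-planar if every edge is crossed by at most $k$ edges. -}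

module Defs where

open import Data.Nat using (ℕ; suc)
open import Data.Fin using (Fin; punchIn)
open import Data.List using (List; length; filter; cartesianProduct; allFin)
open import Data.Bool using (Bool; T)
open import Data.Bool.Properties using (T?)
open import Data.Product using (_×_; _,_)
open import Data.Sum using (_⊎_)
open import Relation.Nullary.Decidable using (_×-dec_; _⊎-dec_)
open import Relation.Binary.PropositionalEquality using (_≡_)
open import Relation.Binary.Structures using (IsStrictTotalOrder)

-- A bipartite graph with bipartition (X , Y), X = Fin m, Y = Fin n,
-- given by its edge relation between X and Y.
Edges : ℕ → ℕ → Set
Edges m n = Fin m → Fin n → Bool

record LinOrd (n : ℕ) : Set₁ where
  field
    _<_ : Fin n → Fin n → Set
    isSTO : IsStrictTotalOrder _≡_ _<_
  open IsStrictTotalOrder isSTO public using (_<?_)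

degX : ∀ {m n} → Edges m n → Fin m → ℕ
degX E x = length (filter (λ y → T? (E x y)) (allFin _))

degY : ∀ {m n} → Edges m n → Fin n → ℕ
degY E y = length (filter (λ x → T? (E x y)) (allFin _))

IsLeafY : ∀ {m n} → Edges m n → Fin n → Set
IsLeafY E y = degY E y ≡ 1

-- G - y : the graph with y ∈ Y deleted; Y ∖ {y} is identified with Fin n
-- via punchIn y : Fin n → Fin (suc n) (the order-free bijection onto Y ∖ {y}).
deleteY : ∀ {m n} → Edges m (suc n) → Fin (suc n) → Edges m n
deleteY E y x j = E x (punchIn y j)

module _ {m n : ℕ} (E : Edges m n) (ox : LinOrd m) (oy : LinOrd n) where
  private
    module OX = LinOrd ox
    module OY = LinOrd oy

  Cross : Fin m × Fin n → Fin m × Fin n → Set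
  Cross (x , y) (x' , y') =
    (OX._<_ x x' × OY._<_ y' y) ⊎ (OX._<_ x' x × OY._<_ y y')

  crossings : Fin m × Fin n → ℕ
  crossings (x , y) =
    length (filter (λ { (x' , y') → T? (E x' y') ×-dec
                 ((OX._<?_ x x' ×-dec OY._<?_ y' y) ⊎-dec (OX._<?_ x' x ×-dec OY._<?_ y y')) })
          (cartesianProduct (allFin m) (allFin n)))

  IsKPlanar : ℕ → Set
  IsKPlanar k = ∀ x y → T (E x y) → crossings (x , y) Data.Nat.≤ k

{-# OPTIONS --safe #-}
-- Deleting y from a k-planar drawing leaves a k-planar drawing of G − y. Conversely, take a k-planar
-- drawing of G − y, in which v still has more than 2k + 1 neighbours. If an edge left of v ended at or
-- above an edge right of v, then every neighbour of v but one would cross one of these two edges, each of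
-- which is crossed at most k times. So the edges left of v end strictly below those right of v, and y
-- can be inserted at this cut: the edge (v , y), the only edge at the leaf y, then crosses nothing, and
-- no other crossing number changes.
module Submission where

open import Defs
open import Level using (Level)
open import Data.Nat using (ℕ; zero; suc; _+_; _*_; _>_; _≤_; _<_; z≤n; s≤s; s<s⁻¹)
open import Data.Nat.Properties using (≤-refl; ≤-reflexive; ≤-trans; <-irrefl; <⇒≱; m≤m+n; m≤n+m; +-mono-≤; +-monoˡ-≤; +-monoʳ-≤; +-identityʳ; +-comm; +-suc; +-0-commutativeMonoid; module ≤-Reasoning)
open import Data.Fin using (Fin; zero; suc; punchIn; punchOut; _≟_)
open import Data.Fin.Properties using (punchIn-injective; punchInᵢ≢i; punchIn-punchOut; punchOut-punchIn; punchOut-injective; any?)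
open import Data.Vec.Functional using (Vector; removeAt)
open import Algebra.Properties.CommutativeMonoid.Sum +-0-commutativeMonoid using (sum; sum-syntax; sum-remove; ∑-distrib-+; sum-cong-≗; sum-replicate-zero)
open import Data.List using (List; length; filter; cartesianProduct; tabulate; map; _++_)
open import Data.List.Properties using (filter-++; length-++; map-tabulate)
open import Data.Bool using (T)
open import Data.Bool.Properties using (T?)
open import Data.Maybe using (Maybe; just; nothing)
open import Data.Maybe.Properties using (just-injective)
open import Data.Product using (Σ; ∃-syntax; _×_; _,_)
open import Data.Sum using (_⊎_; inj₁; inj₂; [_,_]′)
open import Data.Empty using (⊥; ⊥-elim)
open import Function using (_∘_; _on_)
open import Function.Definitions using (Injective)
open import Function.Bundles using (_⇔_; mk⇔)
open import Relation.Nullary using (Dec; yes; no; ¬_)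
open import Relation.Nullary.Decidable using (_×-dec_; _⊎-dec_)
open import Relation.Unary using (Pred; Decidable)
open import Relation.Binary using (Rel; Tri; tri<; tri≈; tri>)
open import Relation.Binary.Structures using (IsStrictTotalOrder)
open import Relation.Binary.PropositionalEquality

private
  variable
    a b p q r : Level
    A : Set a
    B : Set b
    P : Set p
    Q : Set q
    R : Set r

indicator : Dec P → ℕ
indicator (yes _) = 1
indicator (no _)  = 0

indicator-≤1 : (P? : Dec P) → indicator P? ≤ 1
indicator-≤1 (yes _) = ≤-refl
indicator-≤1 (no _)  = z≤n

indicator-yes : (P? : Dec P) → P → indicator P? ≡ 1
indicator-yes (yes _) _  = refl
indicator-yes (no ¬p) p = ⊥-elim (¬p p)

indicator-no : (P? : Dec P) → ¬ P → indicator P? ≡ 0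
indicator-no (yes p) ¬p = ⊥-elim (¬p p)
indicator-no (no _)  _  = refl

indicator-mono : (P? : Dec P) (Q? : Dec Q) → (P → Q) → indicator P? ≤ indicator Q?
indicator-mono (yes _) (yes _) _   = ≤-refl
indicator-mono (yes p) (no ¬q) P⇒Q = ⊥-elim (¬q (P⇒Q p))
indicator-mono (no _)  _       _   = z≤n

indicator-⊎ : (P? : Dec P) (Q? : Dec Q) (R? : Dec R) → (P → Q ⊎ R) →
              indicator P? ≤ indicator Q? + indicator R?
indicator-⊎ (no _)  _       _       _      = z≤n
indicator-⊎ (yes _) (yes _) _       _      = s≤s z≤n
indicator-⊎ (yes _) (no _)  (yes _) _      = ≤-refl
indicator-⊎ (yes p) (no ¬q) (no ¬r) P⇒Q⊎R with P⇒Q⊎R p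
... | inj₁ q = ⊥-elim (¬q q)
... | inj₂ r = ⊥-elim (¬r r)

sum-mono-≤ : ∀ {n} {f g : Vector ℕ n} → (∀ i → f i ≤ g i) → sum f ≤ sum g
sum-mono-≤ {zero}  _   = z≤n
sum-mono-≤ {suc n} f≤g = +-mono-≤ (f≤g zero) (sum-mono-≤ (f≤g ∘ suc))

sum-≡0 : ∀ {n} {f : Vector ℕ n} → (∀ i → f i ≡ 0) → sum f ≡ 0
sum-≡0 {n} f≡0 = trans (sum-cong-≗ f≡0) (sum-replicate-zero n)

sum-removeAt-≤ : ∀ {n} (t : Vector ℕ (suc n)) i → sum (removeAt t i) ≤ sum t
sum-removeAt-≤ t i = ≤-trans (m≤n+m _ (t i)) (≤-reflexive (sym (sum-remove {i = i} t)))

≤-sum : ∀ {n} (t : Vector ℕ n) i → t i ≤ sum t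
≤-sum {suc n} t i = ≤-trans (m≤m+n (t i) _) (≤-reflexive (sym (sum-remove {i = i} t)))

pair-≤-sum : ∀ {n} (t : Vector ℕ n) {i j} → i ≢ j → t i + t j ≤ sum t
pair-≤-sum {suc n} t {i} {j} i≢j = begin
  t i + t j                                ≡⟨ cong (λ l → t i + t l) (punchIn-punchOut i≢j) ⟨
  t i + removeAt t i (punchOut i≢j)        ≤⟨ +-monoʳ-≤ (t i) (≤-sum (removeAt t i) (punchOut i≢j)) ⟩
  t i + sum (removeAt t i)                 ≡⟨ sum-remove t ⟨
  sum t                                    ∎
  where open ≤-Reasoning

sum-≤-except : ∀ {n} (c : Fin n) {f g : Vector ℕ n} → (∀ j → j ≢ c → f j ≤ g j) → sum f ≤ f c + sum g
sum-≤-except {suc n} c {f} {g} f≤g = begin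
  sum f                           ≡⟨ sum-remove f ⟩
  f c + sum (removeAt f c)        ≤⟨ +-monoʳ-≤ (f c) (sum-mono-≤ (λ j → f≤g (punchIn c j) (punchInᵢ≢i c j))) ⟩
  f c + sum (removeAt g c)        ≤⟨ +-monoʳ-≤ (f c) (sum-removeAt-≤ g c) ⟩
  f c + sum g                     ∎
  where open ≤-Reasoning

length-filter-tabulate : ∀ {n} {P : Pred A p} (P? : Decidable P) (f : Fin n → A) →
                         length (filter P? (tabulate f)) ≡ ∑[ i < n ] indicator (P? (f i))
length-filter-tabulate {n = zero}  P? f = refl
length-filter-tabulate {n = suc n} P? f with P? (f zero)
... | yes _ = cong suc (length-filter-tabulate P? (f ∘ suc))
... | no _  = length-filter-tabulate P? (f ∘ suc)

length-filter-cartesianProduct :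
  ∀ {m n} {P : Pred (A × B) p} (P? : Decidable P) (f : Fin m → A) (g : Fin n → B) →
  length (filter P? (cartesianProduct (tabulate f) (tabulate g))) ≡
  ∑[ i < m ] ∑[ j < n ] indicator (P? (f i , g j))
length-filter-cartesianProduct {m = zero}  P? f g = refl
length-filter-cartesianProduct {A = A} {B = B} {m = suc m} {n} P? f g = begin
  length (filter P? (row ++ rest))                   ≡⟨ cong length (filter-++ P? row rest) ⟩
  length (filter P? row ++ filter P? rest)           ≡⟨ length-++ (filter P? row) ⟩
  length (filter P? row) + length (filter P? rest)   ≡⟨ cong₂ _+_ first-row (length-filter-cartesianProduct P? (f ∘ suc) g) ⟩
  ∑[ j < n ] indicator (P? (f zero , g j)) + ∑[ i < m ] ∑[ j < n ] indicator (P? (f (suc i) , g j)) ∎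
  where
  open ≡-Reasoning
  row rest : List (A × B)
  row  = map (f zero ,_) (tabulate g)
  rest = cartesianProduct (tabulate (f ∘ suc)) (tabulate g)
  first-row : length (filter P? row) ≡ ∑[ j < n ] indicator (P? (f zero , g j))
  first-row = trans (cong (length ∘ filter P?) (map-tabulate g (f zero ,_))) (length-filter-tabulate P? (λ j → f zero , g j))

module _ {_<_ : Rel B r} (sto : IsStrictTotalOrder _≡_ _<_) (f : A → B) (f-inj : Injective _≡_ _≡_ f) where
  private module S = IsStrictTotalOrder sto

  isStrictTotalOrder-on : IsStrictTotalOrder _≡_ (_<_ on f)
  isStrictTotalOrder-on = record
    { isStrictPartialOrder = record
      { isEquivalence = isEquivalence
      ; irrefl        = λ { refl → S.irrefl refl }
      ; trans         = S.trans
      ; <-resp-≈      = (λ { refl x<y → x<y }) , (λ { refl x<y → x<y }) }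
    ; compare = compare }
    where
    compare : ∀ x y → Tri (f x < f y) (x ≡ y) (f y < f x)
    compare x y with S.compare (f x) (f y)
    ... | tri< lt ¬eq ¬gt = tri< lt (¬eq ∘ cong f) ¬gt
    ... | tri≈ ¬lt eq ¬gt = tri≈ ¬lt (f-inj eq) ¬gt
    ... | tri> ¬lt ¬eq gt = tri> ¬lt (¬eq ∘ cong f) gt

linOrd-on : ∀ {n} {_<_ : Rel A Level.zero} → IsStrictTotalOrder _≡_ _<_ →
            (f : Fin n → A) → Injective _≡_ _≡_ f → LinOrd n
linOrd-on sto f f-inj = record { isSTO = isStrictTotalOrder-on sto f f-inj }

restrict : ∀ {n} → LinOrd (suc n) → Fin (suc n) → LinOrd n
restrict oy y = linOrd-on (LinOrd.isSTO oy) (punchIn y) (punchIn-injective y _ _)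

module InsertAtCut {A : Set} {_<_ : Rel A Level.zero} (sto : IsStrictTotalOrder _≡_ _<_)
                   {S : Pred A Level.zero} (S? : Decidable S) (S-downward : ∀ {x y} → x < y → S y → S x) where
  private module O = IsStrictTotalOrder sto

  _<ᶜ_ : Rel (Maybe A) Level.zero
  nothing <ᶜ nothing = ⊥
  nothing <ᶜ just y  = ¬ S y
  just x  <ᶜ nothing = S x
  just x  <ᶜ just y  = x < y

  <ᶜ-irrefl : ∀ {x y} → x ≡ y → ¬ (x <ᶜ y)
  <ᶜ-irrefl {nothing} refl ()
  <ᶜ-irrefl {just x}  refl = O.irrefl refl

  <ᶜ-trans : ∀ {x y z} → x <ᶜ y → y <ᶜ z → x <ᶜ z
  <ᶜ-trans {nothing} {just y}  {nothing} ¬Sy Sy  = ¬Sy Sy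
  <ᶜ-trans {nothing} {just y}  {just z}  ¬Sy y<z = ¬Sy ∘ S-downward y<z
  <ᶜ-trans {just x}  {nothing} {just z}  Sx ¬Sz with O.compare x z
  ... | tri< x<z _    _   = x<z
  ... | tri≈ _   refl _   = ⊥-elim (¬Sz Sx)
  ... | tri> _   _    z<x = ⊥-elim (¬Sz (S-downward z<x Sx))
  <ᶜ-trans {just x}  {just y}  {nothing} x<y Sy  = S-downward x<y Sy
  <ᶜ-trans {just x}  {just y}  {just z}  x<y y<z = O.trans x<y y<z

  <ᶜ-compare : ∀ x y → Tri (x <ᶜ y) (x ≡ y) (y <ᶜ x)
  <ᶜ-compare nothing nothing = tri≈ (λ ()) refl (λ ())
  <ᶜ-compare nothing (just y) with S? y
  ... | yes Sy = tri> (λ ¬Sy → ¬Sy Sy) (λ ()) Sy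
  ... | no ¬Sy = tri< ¬Sy (λ ()) ¬Sy
  <ᶜ-compare (just x) nothing with S? x
  ... | yes Sx = tri< Sx (λ ()) (λ ¬Sx → ¬Sx Sx)
  ... | no ¬Sx = tri> ¬Sx (λ ()) ¬Sx
  <ᶜ-compare (just x) (just y) with O.compare x y
  ... | tri< lt ¬eq ¬gt = tri< lt (λ { refl → ¬eq refl }) ¬gt
  ... | tri≈ ¬lt eq ¬gt = tri≈ ¬lt (cong just eq) ¬gt
  ... | tri> ¬lt ¬eq gt = tri> ¬lt (λ { refl → ¬eq refl }) gt

  isStrictTotalOrder : IsStrictTotalOrder _≡_ _<ᶜ_
  isStrictTotalOrder = record
    { isStrictPartialOrder = record
      { isEquivalence = isEquivalence
      ; irrefl        = <ᶜ-irrefl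
      ; trans         = λ {x} {y} {z} → <ᶜ-trans {x} {y} {z}
      ; <-resp-≈      = (λ { refl x<y → x<y }) , (λ { refl x<y → x<y }) }
    ; compare = <ᶜ-compare }

punchOutMaybe : ∀ {n} → Fin (suc n) → Fin (suc n) → Maybe (Fin n)
punchOutMaybe i j with i ≟ j
... | yes _   = nothing
... | no  i≢j = just (punchOut i≢j)

punchOutMaybe-self : ∀ {n} (i : Fin (suc n)) → punchOutMaybe i i ≡ nothing
punchOutMaybe-self i with i ≟ i
... | yes _   = refl
... | no  i≢i = ⊥-elim (i≢i refl)

punchOutMaybe-punchIn : ∀ {n} (i : Fin (suc n)) j → punchOutMaybe i (punchIn i j) ≡ just j
punchOutMaybe-punchIn i j with i ≟ punchIn i j
... | yes i≡ = ⊥-elim (punchInᵢ≢i i j (sym i≡))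
... | no  i≢ = cong just (punchOut-punchIn i)

punchOutMaybe-injective : ∀ {n} (i : Fin (suc n)) → Injective _≡_ _≡_ (punchOutMaybe i)
punchOutMaybe-injective i {j} {k} eq with i ≟ j | i ≟ k
punchOutMaybe-injective i {j} {k} eq   | yes i≡j | yes i≡k = trans (sym i≡j) i≡k
punchOutMaybe-injective i {j} {k} ()   | yes _   | no  _
punchOutMaybe-injective i {j} {k} ()   | no  _   | yes _
punchOutMaybe-injective i {j} {k} eq   | no  i≢j | no  i≢k = punchOut-injective i≢j i≢k (just-injective eq)

≡-or-punchIn : ∀ {n} (i j : Fin (suc n)) → j ≡ i ⊎ ∃[ l ] j ≡ punchIn i l
≡-or-punchIn i j with i ≟ j
... | yes i≡j = inj₁ (sym i≡j)
... | no  i≢j = inj₂ (punchOut i≢j , sym (punchIn-punchOut i≢j))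

module _ {m n} (E : Edges m n) where

  degX-≡-∑ : ∀ x → degX E x ≡ ∑[ j < n ] indicator (T? (E x j))
  degX-≡-∑ x = length-filter-tabulate (λ j → T? (E x j)) (λ j → j)

  degY-≡-∑ : ∀ y → degY E y ≡ ∑[ x < m ] indicator (T? (E x y))
  degY-≡-∑ y = length-filter-tabulate (λ x → T? (E x y)) (λ x → x)

  leaf-unique : ∀ {y v x} → IsLeafY E y → T (E v y) → T (E x y) → x ≡ v
  leaf-unique {y} {v} {x} leaf vy xy with v ≟ x
  ... | yes v≡x = sym v≡x
  ... | no  v≢x = ⊥-elim (<-irrefl (sym leaf) (begin-strict
    1                                              <⟨ s≤s (s≤s z≤n) ⟩
    2                                              ≡⟨ cong₂ _+_ (indicator-yes (T? (E v y)) vy) (indicator-yes (T? (E x y)) xy) ⟨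
    indicator (T? (E v y)) + indicator (T? (E x y)) ≤⟨ pair-≤-sum (λ x → indicator (T? (E x y))) v≢x ⟩
    ∑[ x < m ] indicator (T? (E x y))              ≡⟨ degY-≡-∑ y ⟨
    degY E y                                       ∎))
    where open ≤-Reasoning

degX-deleteY : ∀ {m n} (E : Edges m (suc n)) y v → degX E v ≡ indicator (T? (E v y)) + degX (deleteY E y) v
degX-deleteY {n = n} E y v = begin
  degX E v                                                                 ≡⟨ degX-≡-∑ E v ⟩
  ∑[ j < suc n ] indicator (T? (E v j))                                    ≡⟨ sum-remove {i = y} (λ j → indicator (T? (E v j))) ⟩
  indicator (T? (E v y)) + ∑[ j < n ] indicator (T? (E v (punchIn y j)))   ≡⟨ cong (_ +_) (degX-≡-∑ (deleteY E y) v) ⟨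
  indicator (T? (E v y)) + degX (deleteY E y) v                            ∎
  where open ≡-Reasoning

module _ {m n} (E : Edges m n) (ox : LinOrd m) (oy : LinOrd n) where
  private
    module X = LinOrd ox
    module Y = LinOrd oy

  Crosses : Fin m → Fin n → Fin m → Fin n → Set
  Crosses x j x′ j′ = T (E x′ j′) × Cross E ox oy (x , j) (x′ , j′)

  crosses? : ∀ x j x′ j′ → Dec (Crosses x j x′ j′)
  crosses? x j x′ j′ = T? (E x′ j′) ×-dec ((x X.<? x′ ×-dec j′ Y.<? j) ⊎-dec (x′ X.<? x ×-dec j Y.<? j′))

  crossings-≡-∑ : ∀ x j → crossings E ox oy (x , j) ≡ ∑[ x′ < m ] ∑[ j′ < n ] indicator (crosses? x j x′ j′)
  crossings-≡-∑ x j = length-filter-cartesianProduct {m = m} {n} _ (λ x′ → x′) (λ j′ → j′)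

  crossings-at-≤ : ∀ x j x′ → ∑[ j′ < n ] indicator (crosses? x j x′ j′) ≤ crossings E ox oy (x , j)
  crossings-at-≤ x j x′ = ≤-trans (≤-sum _ x′) (≤-reflexive (sym (crossings-≡-∑ x j)))

Cross-sym : ∀ {m n} {E : Edges m n} {ox oy} {e f} → Cross E ox oy e f → Cross E ox oy f e
Cross-sym (inj₁ (x<x′ , j′<j)) = inj₂ (x<x′ , j′<j)
Cross-sym (inj₂ (x′<x , j<j′)) = inj₁ (x′<x , j<j′)

module _ {m n} (E : Edges m n) (ox : LinOrd m) (oy : LinOrd n) {k} (planar : IsKPlanar E ox oy k) where
  private
    module X = LinOrd ox
    module Y = LinOrd oy
    module Yˢ = IsStrictTotalOrder Y.isSTO

  degX-≤-between-unseparated : ∀ {v x₁ x₂ j₁ j₂} → x₁ X.< v → v X.< x₂ → T (E x₁ j₁) → T (E x₂ j₂) →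
                               j₂ ≡ j₁ ⊎ j₂ Y.< j₁ → degX E v ≤ 2 * k + 1
  degX-≤-between-unseparated {v} {x₁} {x₂} {j₁} {j₂} x₁<v v<x₂ e₁ e₂ j₂≤j₁ = begin
    degX E v                                          ≡⟨ degX-≡-∑ E v ⟩
    ∑[ j < n ] nbr j                                  ≤⟨ sum-≤-except j₁ cover ⟩
    nbr j₁ + ∑[ j < n ] (cross₁ j + cross₂ j)         ≤⟨ +-monoˡ-≤ _ (indicator-≤1 (T? (E v j₁))) ⟩
    1 + ∑[ j < n ] (cross₁ j + cross₂ j)              ≡⟨ cong (1 +_) (∑-distrib-+ cross₁ cross₂) ⟩
    1 + (∑[ j < n ] cross₁ j + ∑[ j < n ] cross₂ j)   ≤⟨ +-monoʳ-≤ 1 (+-mono-≤ (crossings-≤ x₁ j₁ e₁) (crossings-≤ x₂ j₂ e₂)) ⟩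
    1 + (k + k)                                       ≡⟨ cong (λ t → 1 + (k + t)) (+-identityʳ k) ⟨
    1 + 2 * k                                         ≡⟨ +-comm 1 (2 * k) ⟩
    2 * k + 1                                         ∎
    where
    open ≤-Reasoning
    nbr cross₁ cross₂ : Fin n → ℕ
    nbr j = indicator (T? (E v j))
    cross₁ j = indicator (crosses? E ox oy x₁ j₁ v j)
    cross₂ j = indicator (crosses? E ox oy x₂ j₂ v j)

    crossings-≤ : ∀ x j → T (E x j) → ∑[ j′ < n ] indicator (crosses? E ox oy x j v j′) ≤ k
    crossings-≤ x j xj = ≤-trans (crossings-at-≤ E ox oy x j v) (planar x j xj)

    crosses-one : ∀ {j} → j ≢ j₁ → T (E v j) → Crosses E ox oy x₁ j₁ v j ⊎ Crosses E ox oy x₂ j₂ v j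
    crosses-one {j} j≢j₁ vj with Yˢ.compare j j₁
    ... | tri< j<j₁ _ _ = inj₁ (vj , inj₁ (x₁<v , j<j₁))
    ... | tri≈ _ j≡j₁ _ = ⊥-elim (j≢j₁ j≡j₁)
    ... | tri> _ _ j₁<j = inj₂ (vj , inj₂ (v<x₂ , [ (λ j₂≡j₁ → subst (Y._< j) (sym j₂≡j₁) j₁<j)
                                                 , (λ j₂<j₁ → Yˢ.trans j₂<j₁ j₁<j) ]′ j₂≤j₁))

    cover : ∀ j → j ≢ j₁ → nbr j ≤ cross₁ j + cross₂ j
    cover j j≢j₁ = indicator-⊎ (T? (E v j)) (crosses? E ox oy x₁ j₁ v j) (crosses? E ox oy x₂ j₂ v j) (crosses-one j≢j₁)

  high-degree-separates : ∀ {v x₁ x₂ j₁ j₂} → 2 * k + 1 < degX E v → x₁ X.< v → v X.< x₂ →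
                          T (E x₁ j₁) → T (E x₂ j₂) → j₁ Y.< j₂
  high-degree-separates {j₁ = j₁} {j₂} deg x₁<v v<x₂ e₁ e₂ with Yˢ.compare j₁ j₂
  ... | tri< j₁<j₂ _ _ = j₁<j₂
  ... | tri≈ _ j₁≡j₂ _ = ⊥-elim (<⇒≱ deg (degX-≤-between-unseparated x₁<v v<x₂ e₁ e₂ (inj₁ (sym j₁≡j₂))))
  ... | tri> _ _ j₂<j₁ = ⊥-elim (<⇒≱ deg (degX-≤-between-unseparated x₁<v v<x₂ e₁ e₂ (inj₂ j₂<j₁)))

module _ {m n} (E : Edges m (suc n)) (ox : LinOrd m) (oy : LinOrd (suc n)) (y : Fin (suc n)) where

  crossings-deleteY-≤ : ∀ x j → crossings (deleteY E y) ox (restrict oy y) (x , j) ≤ crossings E ox oy (x , punchIn y j)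
  crossings-deleteY-≤ x j = begin
    crossings (deleteY E y) ox (restrict oy y) (x , j)
      ≡⟨ crossings-≡-∑ (deleteY E y) ox (restrict oy y) x j ⟩
    ∑[ x′ < m ] ∑[ j′ < n ] indicator (crosses? (deleteY E y) ox (restrict oy y) x j x′ j′)
      ≤⟨ sum-mono-≤ (λ x′ → sum-mono-≤ (λ j′ →
           indicator-mono (crosses? (deleteY E y) ox (restrict oy y) x j x′ j′)
                          (crosses? E ox oy x (punchIn y j) x′ (punchIn y j′)) (λ cr → cr))) ⟩
    ∑[ x′ < m ] ∑[ j′ < n ] indicator (crosses? E ox oy x (punchIn y j) x′ (punchIn y j′))
      ≤⟨ sum-mono-≤ (λ x′ → sum-removeAt-≤ (λ b → indicator (crosses? E ox oy x (punchIn y j) x′ b)) y) ⟩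
    ∑[ x′ < m ] ∑[ b < suc n ] indicator (crosses? E ox oy x (punchIn y j) x′ b)
      ≡⟨ crossings-≡-∑ E ox oy x (punchIn y j) ⟨
    crossings E ox oy (x , punchIn y j)
      ∎
    where open ≤-Reasoning

  deleteY-kPlanar : ∀ {k} → IsKPlanar E ox oy k → IsKPlanar (deleteY E y) ox (restrict oy y) k
  deleteY-kPlanar planar x j xj = ≤-trans (crossings-deleteY-≤ x j) (planar x (punchIn y j) xj)

module InsertLeaf {m n} (E : Edges m (suc n)) (ox : LinOrd m) (oy′ : LinOrd n) (v : Fin m) (y : Fin (suc n))
                  (y-leaf : ∀ {x} → T (E x y) → x ≡ v)
                  (separated : ∀ {x₁ x₂ j₁ j₂} → LinOrd._<_ ox x₁ v → LinOrd._<_ ox v x₂ →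
                               T (deleteY E y x₁ j₁) → T (deleteY E y x₂ j₂) → LinOrd._<_ oy′ j₁ j₂) where
  private
    module X = LinOrd ox
    module Y′ = LinOrd oy′
    module Y′ˢ = IsStrictTotalOrder Y′.isSTO
    E′ : Edges m n
    E′ = deleteY E y

  BelowLeft : Pred (Fin n) Level.zero
  BelowLeft j = ∃[ x₁ ] ∃[ j₁ ] x₁ X.< v × T (E′ x₁ j₁) × (j ≡ j₁ ⊎ j Y′.< j₁)

  belowLeft? : Decidable BelowLeft
  belowLeft? j = any? λ x₁ → any? λ j₁ → x₁ X.<? v ×-dec T? (E′ x₁ j₁) ×-dec (j ≟ j₁ ⊎-dec j Y′.<? j₁)

  belowLeft-downward : ∀ {i j} → i Y′.< j → BelowLeft j → BelowLeft i
  belowLeft-downward i<j (x₁ , j₁ , x₁<v , e₁ , inj₁ refl)  = x₁ , j₁ , x₁<v , e₁ , inj₂ i<j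
  belowLeft-downward i<j (x₁ , j₁ , x₁<v , e₁ , inj₂ j<j₁) = x₁ , j₁ , x₁<v , e₁ , inj₂ (Y′ˢ.trans i<j j<j₁)

  private module Cut = InsertAtCut Y′.isSTO belowLeft? belowLeft-downward

  oy : LinOrd (suc n)
  oy = linOrd-on Cut.isStrictTotalOrder (punchOutMaybe y) (punchOutMaybe-injective y)

  private
    module Y = LinOrd oy
    module Yˢ = IsStrictTotalOrder Y.isSTO

  punchIn<y : ∀ {j} → punchIn y j Y.< y → BelowLeft j
  punchIn<y {j} lt rewrite punchOutMaybe-punchIn y j | punchOutMaybe-self y = lt

  y<punchIn : ∀ {j} → y Y.< punchIn y j → ¬ BelowLeft j
  y<punchIn {j} lt rewrite punchOutMaybe-punchIn y j | punchOutMaybe-self y = lt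

  punchIn<punchIn : ∀ {i j} → punchIn y i Y.< punchIn y j → i Y′.< j
  punchIn<punchIn {i} {j} lt rewrite punchOutMaybe-punchIn y i | punchOutMaybe-punchIn y j = lt

  leaf-edge-uncrossed : ∀ {x′ b} → T (E x′ b) → ¬ Cross E ox oy (v , y) (x′ , b)
  leaf-edge-uncrossed {x′} {b} x′b cr with ≡-or-punchIn y b
  leaf-edge-uncrossed x′b (inj₁ (_ , y<y)) | inj₁ refl = Yˢ.irrefl refl y<y
  leaf-edge-uncrossed x′b (inj₂ (_ , y<y)) | inj₁ refl = Yˢ.irrefl refl y<y
  leaf-edge-uncrossed x′b (inj₁ (v<x′ , j<y)) | inj₂ (j , refl) with punchIn<y j<y
  ... | x₁ , j₁ , x₁<v , e₁ , inj₁ refl  = Y′ˢ.irrefl refl (separated x₁<v v<x′ e₁ x′b)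
  ... | x₁ , j₁ , x₁<v , e₁ , inj₂ j<j₁ = Y′ˢ.asym j<j₁ (separated x₁<v v<x′ e₁ x′b)
  leaf-edge-uncrossed {x′} x′b (inj₂ (x′<v , y<j)) | inj₂ (j , refl) = y<punchIn y<j (x′ , j , x′<v , x′b , inj₁ refl)

  crossings-leaf-edge : ∀ {x} → T (E x y) → crossings E ox oy (x , y) ≡ 0
  crossings-leaf-edge {x} xy with y-leaf xy
  ... | refl = trans (crossings-≡-∑ E ox oy v y) (sum-≡0 λ x′ → sum-≡0 λ b →
                 indicator-no (crosses? E ox oy v y x′ b) λ (x′b , cr) → leaf-edge-uncrossed x′b cr)

  crossings-punchIn-≤ : ∀ {x j} → T (E′ x j) → crossings E ox oy (x , punchIn y j) ≤ crossings E′ ox oy′ (x , j)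
  crossings-punchIn-≤ {x} {j} xj = begin
    crossings E ox oy (x , punchIn y j)
      ≡⟨ crossings-≡-∑ E ox oy x (punchIn y j) ⟩
    ∑[ x′ < m ] ∑[ b < suc n ] crossing x′ b
      ≡⟨ sum-cong-≗ (λ x′ → sum-remove {i = y} (crossing x′)) ⟩
    ∑[ x′ < m ] (crossing x′ y + ∑[ j′ < n ] crossing x′ (punchIn y j′))
      ≤⟨ sum-mono-≤ (λ x′ → +-mono-≤ (≤-reflexive (indicator-no _ (not-crossing-leaf-edge x′)))
                                      (sum-mono-≤ (λ j′ → indicator-mono _ (crosses? E′ ox oy′ x j x′ j′) restricted))) ⟩
    ∑[ x′ < m ] ∑[ j′ < n ] indicator (crosses? E′ ox oy′ x j x′ j′)
      ≡⟨ crossings-≡-∑ E′ ox oy′ x j ⟨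
    crossings E′ ox oy′ (x , j)
      ∎
    where
    open ≤-Reasoning
    crossing : Fin m → Fin (suc n) → ℕ
    crossing x′ b = indicator (crosses? E ox oy x (punchIn y j) x′ b)

    not-crossing-leaf-edge : ∀ x′ → ¬ Crosses E ox oy x (punchIn y j) x′ y
    not-crossing-leaf-edge x′ (x′y , cr) with y-leaf x′y
    ... | refl = leaf-edge-uncrossed xj (Cross-sym {E = E} {ox} {oy} cr)

    restricted : ∀ {x′ j′} → Crosses E ox oy x (punchIn y j) x′ (punchIn y j′) → Crosses E′ ox oy′ x j x′ j′
    restricted (x′j′ , inj₁ (x<x′ , lt)) = x′j′ , inj₁ (x<x′ , punchIn<punchIn lt)
    restricted (x′j′ , inj₂ (x′<x , lt)) = x′j′ , inj₂ (x′<x , punchIn<punchIn lt)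

  kPlanar : ∀ {k} → IsKPlanar E′ ox oy′ k → IsKPlanar E ox oy k
  kPlanar planar′ x b xb with ≡-or-punchIn y b
  ... | inj₁ refl       = ≤-trans (≤-reflexive (crossings-leaf-edge xb)) z≤n
  ... | inj₂ (j , refl) = ≤-trans (crossings-punchIn-≤ xb) (planar′ x j xb)

lemma2 : (k m n : ℕ) (E : Edges m (suc n)) (ox : LinOrd m) (v : Fin m) (y : Fin (suc n)) →
         degX E v > 2 * k + 2 → T (E v y) → IsLeafY E y →
         (Σ (LinOrd (suc n)) (λ oy → IsKPlanar E ox oy k)) ⇔
         (Σ (LinOrd n) (λ oy′ → IsKPlanar (deleteY E y) ox oy′ k))
lemma2 k m n E ox v y deg vy leaf = mk⇔
  (λ (oy , planar) → restrict oy y , deleteY-kPlanar E ox oy y planar)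
  (λ (oy′ , planar′) → let module L = InsertLeaf E ox oy′ v y (leaf-unique E leaf vy)
                                                 (high-degree-separates (deleteY E y) ox oy′ planar′ deg′)
                       in L.oy , L.kPlanar planar′)
  where
  deg′ : 2 * k + 1 < degX (deleteY E y) v
  deg′ = s<s⁻¹ (begin-strict
    suc (2 * k + 1)                                        ≡⟨ +-suc (2 * k) 1 ⟨
    2 * k + 2                                              <⟨ deg ⟩
    degX E v                                               ≡⟨ degX-deleteY E y v ⟩
    indicator (T? (E v y)) + degX (deleteY E y) v          ≤⟨ +-monoˡ-≤ _ (indicator-≤1 (T? (E v y))) ⟩
    suc (degX (deleteY E y) v)                             ∎)
    where open ≤-Reasoning
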